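{- Let $m\ge2$ and $n\ge 2$ be integers, and let $k$ be an integer with $1\le k\le n^2-3n+2$, written $k=(n-1)q+r$ with $q\ge0$ and $1\le r\le n-1$. Let $\mathbb{A}_0$ and $\mathbb{A}_k$ be the tensors of order $m$ and dimension $n$ defined in the context. Then for every integer $t\in\{1,\ldots,k\}$, $S_t(\mathbb{A}_k,n-1)=S_t(\mathbb{A}_0,n-1)$.
   Context: A tensor of order $m$ and dimension $n$ is an array $(a_{i_1\cdots i_m})$ with indices in $[n]=\{1,\ldots,n\}$. General product: if $\mathbb{A}$ has order $m\ge2$ and $\mathbb{B}$ has order $p\ge1$, then $\mathbb{A}\mathbb{B}$ is the tensor of order $(m-1)(p-1)+1$ with entries $d_{i\alpha_1\cdots\alpha_{m-1}}=\sum_{i_2,\ldots,i_m=1}^n a_{ii_2\cdots i_m}b_{i_2\alpha_1}\cdots b_{i_m\alpha_{m-1}}$ ($\alpha_l\in[n]^{p-1}$); it is associative, and $\mathbb{A}^{t+1}=\mathbb{A}\mathbb{A}^t$. The majorization matrix of a tensor $\mathbb{B}$ is $(M(\mathbb{B}))_{ij}=b_{ij\cdots j}$. For a nonnegative tensor $\mathbb{A}$, $j\in[n]$ and $t\ge1$, $S_t(\mathbb{A},j)=\{u\in[n]: (M(\mathbb{A}^t))_{uj}>0\}$. $|a|_n$ is the unique element of $\{1,\ldots,n\}$ congruent to $a$ mod $n$. $M_1$ is the $n\times n$ $0$-$1$ matrix with $(M_1)_{1,n-1}=(M_1)_{1,n}=1$, $(M_1)_{i+1,i}=1$ ($1\le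 i\le n-1$), other entries $0$. $\mathbb{A}_0=(a_{i_1\cdots i_m})$ has $a_{ij\cdots j}=(M_1)_{ij}$ and $a_{ii_2\cdots i_m}=0$ whenever $i_2,\ldots,i_m$ are not all equal. $\mathbb{A}_k=(a^{(k)}_{i_1\cdots i_m})$ has $a^{(k)}_{ij\cdots j}=(M_1)_{ij}$; $a^{(k)}_{ii_2\cdots i_m}=1$ if $i\notin\{|r-q|_n,|r-q+1|_n,\ldots,|r+1|_n\}$ and the set of distinct values among $i_2,\ldots,i_m$ equals $\{|r-q-1|_n,|r|_n\}$; all other entries $0$. -}

module Defs where

open import Data.Nat using (ℕ; zero; suc; _+_; _*_; _∸_; _^_; _≡ᵇ_)
open import Data.Nat.Divisibility using (_∣?_)
open import Data.Integer using (ℤ; +_; ∣_∣) renaming (_-_ to _-ℤ_; _+_ to _+ℤ_)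
open import Data.Bool using (Bool; true; false; if_then_else_; _∧_; _∨_; not)
open import Data.Fin using (Fin; toℕ; _≟_)
open import Data.Vec using (Vec; []; _∷_; splitAt; zipWith; replicate; toList)
import Data.List as L
open import Data.List using (List; allFin; upTo)
open import Data.Product using (proj₁; proj₂)
open import Relation.Nullary.Decidable using (⌊_⌋)
open import Data.Bool.ListAction using (any; all)
open import Data.Nat.ListAction using (sum)

-- Tensors of order p and dimension n with nonnegative integer entries.
-- Index i ∈ Fin n stands for the paper's index toℕ i + 1 ∈ {1,…,n}.

Tensor : ℕ → ℕ → Set
Tensor n p = Vec (Fin n) p → ℕ

sumFin : ∀ {n} → (Fin n → ℕ) → ℕ
sumFin {n} f = sum (L.map f (allFin n))

sumAll : ∀ {n} (k : ℕ) → (Vec (Fin n) k → ℕ) → ℕ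
sumAll zero    f = f []
sumAll (suc k) f = sumFin (λ i → sumAll k (λ v → f (i ∷ v)))

prodVec : ∀ {k} → Vec ℕ k → ℕ
prodVec []       = 1
prodVec (x ∷ xs) = x * prodVec xs

chunks : ∀ {X : Set} (a b : ℕ) → Vec X (a * b) → Vec (Vec X b) a
chunks zero    b xs = []
chunks (suc a) b xs = proj₁ (splitAt b xs) ∷ chunks a b (proj₁ (proj₂ (splitAt b xs)))

-- General product: A of order a+1, B of order b+1, AB of order a*b+1,
-- (AB)_{i α₁ … α_a} = Σ_{i₂…i_{a+1}} a_{i i₂ … } b_{i₂ α₁} ⋯ b_{i_{a+1} α_a}.
tmul : ∀ {n a b} → Tensor n (suc a) → Tensor n (suc b) → Tensor n (suc (a * b))
tmul {n} {a} {b} A B (i ∷ is) =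
  sumAll a (λ js → A (i ∷ js) * prodVec (zipWith (λ j α → B (j ∷ α)) js (chunks a b is)))

idT : ∀ {n} → Tensor n 2
idT (i ∷ j ∷ []) = if ⌊ i ≟ j ⌋ then 1 else 0

-- powers: A^0 = I, A^{t+1} = A A^t  (so A^1 = A I = A);
-- A^t has order (m-1)^t + 1 when A has order m = a+1.
tpow : ∀ {n a} → Tensor n (suc a) → (t : ℕ) → Tensor n (suc (a ^ t))
tpow A zero    = idT
tpow A (suc t) = tmul A (tpow A t)

majM : ∀ {n p} → Tensor n (suc p) → Fin n → Fin n → ℕ
majM {p = p} B i j = B (i ∷ replicate p j)

-- u ∈ S_t(A, j)  iff  (M(A^t))_{uj} > 0
InS : ∀ {n a} → Tensor n (suc a) → ℕ → Fin n → Fin n → Set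
InS A t j u = 0 Data.Nat.< majM (tpow A t) u j

-- The matrix M₁ (0-based: row 0 has ones in columns n-2, n-1;
-- entry (i+1, i) is 1).

M1 : (n : ℕ) → Fin n → Fin n → ℕ
M1 n i j =
  if ((toℕ i ≡ᵇ 0) ∧ ((toℕ j + 2 ≡ᵇ n) ∨ (toℕ j + 1 ≡ᵇ n))) ∨ (toℕ i ≡ᵇ suc (toℕ j))
  then 1 else 0

-- The paper's index of u is toℕ u + 1; "toℕ u + 1 = |x|_n" (x ∈ ℤ)
-- iff n divides (toℕ u + 1) - x.
isAbs : (n : ℕ) → Fin n → ℤ → Bool
isAbs n u x = ⌊ n ∣? ∣ (+ (suc (toℕ u))) -ℤ x ∣ ⌋

allEq : ∀ {n} → Fin n → List (Fin n) → Bool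
allEq j xs = all (λ v → ⌊ v ≟ j ⌋) xs

-- order-m tensors are Tensor n (suc (m ∸ 1)) (m ≥ 2 assumed in the statement)

A0 : (m n : ℕ) → Tensor n (suc (m ∸ 1))
A0 m n (i ∷ is) with toList is
... | L.[]       = 0
... | j L.∷ rest = if allEq j rest then M1 n i j else 0

-- u ∈ {|r-q|_n, |r-q+1|_n, …, |r+1|_n}
inBlock : (n q r : ℕ) → Fin n → Bool
inBlock n q r u =
  any (λ s → isAbs n u ((+ r -ℤ + q) +ℤ + s)) (upTo (q + 2))

-- the set of distinct values of xs equals {|x|_n, |y|_n}
valsEq : (n : ℕ) → ℤ → ℤ → List (Fin n) → Bool
valsEq n x y xs =
  all (λ v → isAbs n v x ∨ isAbs n v y) xs
  ∧ any (λ v → isAbs n v x) xs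
  ∧ any (λ v → isAbs n v y) xs

Ak : (m n q r : ℕ) → Tensor n (suc (m ∸ 1))
Ak m n q r (i ∷ is) with toList is
... | L.[]       = 0
... | j L.∷ rest =
  if allEq j rest then M1 n i j
  else (if not (inBlock n q r i) ∧ valsEq n ((+ r -ℤ + q) -ℤ + 1) (+ r) (j L.∷ rest)
        then 1 else 0)

module Submission where

-- Indices are 0-based here: the paper's vertex n-1 is j with toℕ j = n - 2, and we
-- write n = n₂ + 2.  The two sets are compared by induction on t.
--
-- * TensorPowers: for any tensor A, u ∈ S_{t+1}(A, j) iff some entry A(u, I) > 0 has
--   all indices of I in S_t(A, j).  Both tensors have M₁ as majorization matrix and
--   A₀ has no other nonzero entries, so S_{t+1}(A₀) = Pre S_t(A₀), the vertices with
--   an M₁-edge into S_t(A₀).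
-- * Congruence, Cycle: modulo n, M₁ is the cycle v → v - 1 plus the chord 0 → n - 2,
--   and Pre maps an arc of consecutive residues to the shifted arc (one longer when it
--   passes the chord).  Hence S_{1+e+p(n-1)}(A₀) is the arc {e, e-1, …, e-p-1}.
-- * outside-block: the extra entries of A_k require both |r-q-1|_n and |r|_n in S_t;
--   for t < k the arc S_t(A₀) is then so placed that every vertex outside the block
--   {|r-q|_n, …, |r+1|_n} lies on the shifted arc, i.e. already in S_{t+1}(A₀).
-- * Agreement: with these, S_t(A_k) = S_t(A₀) follows by induction on t ≤ k; the
--   bound k ≤ n² - 3n + 2 only serves to give q ≤ n - 2.

open import Defs
open import Data.Nat using (ℕ; zero; suc; _≤_; _<_; z≤n; s≤s; NonZero)
import Data.Nat as ℕ
import Data.Nat.Properties as ℕ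
open import Data.Fin using (Fin; toℕ; _≟_)
open import Data.Vec using (Vec; []; _∷_; replicate; toList)
open import Data.Bool using (Bool; true; false; T; if_then_else_)
open import Data.Unit using (tt)
open import Data.Product using (∃; _×_; _,_; proj₁; proj₂)
open import Data.Sum using (_⊎_; inj₁; inj₂)
open import Function.Bundles using (Equivalence)
open import Relation.Unary using (_⊆_; _≐_)
open import Relation.Nullary using (¬_; contradiction; yes; no)
open import Relation.Binary.PropositionalEquality using (_≡_; refl; sym; trans; cong; subst; subst₂)

module TensorPowers where

  open import Data.Nat using (_+_; _*_; _^_)
  open import Data.Nat.Properties using (m≤m+n; m≤n+m; <-≤-trans; *-zeroʳ; n≮0)
  open import Data.Vec using (zipWith; splitAt)
  open import Data.Vec.Relation.Unary.All using (All; []; _∷_)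
  import Data.List as List
  open import Data.List using (allFin)
  open import Data.List.Membership.Propositional using (_∈_)
  open import Data.List.Relation.Unary.Any using (here; there)
  open import Data.List.Membership.Propositional.Properties using (∈-allFin)
  open import Data.Nat.ListAction using (sum)

  *-pos⁻ : ∀ x y → 0 < x * y → 0 < x × 0 < y
  *-pos⁻ (suc x) (suc y) _ = s≤s z≤n , s≤s z≤n
  *-pos⁻ (suc x) zero h = contradiction (subst (0 <_) (*-zeroʳ x) h) n≮0

  *-pos⁺ : ∀ {x y} → 0 < x → 0 < y → 0 < x * y
  *-pos⁺ {suc x} {suc y} _ _ = s≤s z≤n

  sum-pos⁻ : ∀ {X : Set} (f : X → ℕ) xs → 0 < sum (List.map f xs) → ∃ λ x → 0 < f x
  sum-pos⁻ f (x List.∷ xs) h with f x in fx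
  ... | zero  = sum-pos⁻ f xs h
  ... | suc _ = x , subst (0 <_) (sym fx) (s≤s z≤n)

  sum-pos⁺ : ∀ {X : Set} (f : X → ℕ) {xs x} → x ∈ xs → 0 < f x → 0 < sum (List.map f xs)
  sum-pos⁺ f {x List.∷ _} (here refl) h = <-≤-trans h (m≤m+n (f x) _)
  sum-pos⁺ f {y List.∷ _} (there x∈xs) h = <-≤-trans (sum-pos⁺ f x∈xs h) (m≤n+m _ (f y))

  sumAll-pos⁻ : ∀ {n} k (f : Vec (Fin n) k → ℕ) → 0 < sumAll k f → ∃ λ v → 0 < f v
  sumAll-pos⁻ zero f h = [] , h
  sumAll-pos⁻ {n} (suc k) f h with sum-pos⁻ (λ i → sumAll k (λ v → f (i ∷ v))) (allFin n) h
  ... | i , hi with sumAll-pos⁻ k (λ v → f (i ∷ v)) hi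
  ...   | v , hv = i ∷ v , hv

  sumAll-pos⁺ : ∀ {n} k (f : Vec (Fin n) k → ℕ) v → 0 < f v → 0 < sumAll k f
  sumAll-pos⁺ zero f [] h = h
  sumAll-pos⁺ (suc k) f (i ∷ v) h =
    sum-pos⁺ (λ i → sumAll k (λ v → f (i ∷ v))) (∈-allFin i) (sumAll-pos⁺ k (λ v → f (i ∷ v)) v h)

  prod-pos⁻ : ∀ {X Y : Set} {a} (g : X → Y → ℕ) (is : Vec X a) c →
    0 < prodVec (zipWith g is (replicate a c)) → All (λ i → 0 < g i c) is
  prod-pos⁻ g [] c h = []
  prod-pos⁻ g (i ∷ is) c h = proj₁ split ∷ prod-pos⁻ g is c (proj₂ split)
    where
      split : 0 < g i c × 0 < prodVec (zipWith g is (replicate _ c))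
      split = *-pos⁻ (g i c) _ h

  prod-pos⁺ : ∀ {X Y : Set} {a} (g : X → Y → ℕ) (is : Vec X a) c →
    All (λ i → 0 < g i c) is → 0 < prodVec (zipWith g is (replicate a c))
  prod-pos⁺ g [] c [] = s≤s z≤n
  prod-pos⁺ g (i ∷ is) c (h ∷ hs) = *-pos⁺ h (prod-pos⁺ g is c hs)

  take-replicate : ∀ {X : Set} b {c} (x : X) → proj₁ (splitAt b (replicate (b + c) x)) ≡ replicate b x
  take-replicate zero x = refl
  take-replicate (suc b) x = cong (x ∷_) (take-replicate b x)

  drop-replicate : ∀ {X : Set} b {c} (x : X) → proj₁ (proj₂ (splitAt b (replicate (b + c) x))) ≡ replicate c x
  drop-replicate zero x = refl
  drop-replicate (suc b) x = drop-replicate b x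

  chunks-replicate : ∀ {X : Set} a b (x : X) → chunks a b (replicate (a * b) x) ≡ replicate a (replicate b x)
  chunks-replicate zero b x = refl
  chunks-replicate (suc a) b x rewrite take-replicate b {a * b} x | drop-replicate b {a * b} x =
    cong (replicate b x ∷_) (chunks-replicate a b x)

  -- For any tensor A of order a+1, u ∈ S_{t+1}(A,j) iff some entry A(u,I) is positive
  -- with every index of I in S_t(A,j): the entry (A·A^t)_{u j⋯j} is
  -- Σ_I A(u,I) Π_l M(A^t)_{I_l j}.
  module _ {n a : ℕ} (A : Tensor n (suc a)) (t : ℕ) (j : Fin n) where

    private
      entry : Fin n → Vec (Fin n) (a ^ t) → ℕ
      entry i α = tpow A t (i ∷ α)

    S-suc⁻ : ∀ u → InS A (suc t) j u → ∃ λ I → 0 < A (u ∷ I) × All (InS A t j) I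
    S-suc⁻ u h with sumAll-pos⁻ a _ h
    ... | I , hI rewrite chunks-replicate a (a ^ t) j =
      I , proj₁ (*-pos⁻ (A (u ∷ I)) _ hI) , prod-pos⁻ entry I (replicate (a ^ t) j) (proj₂ (*-pos⁻ (A (u ∷ I)) _ hI))

    S-suc⁺ : ∀ u I → 0 < A (u ∷ I) → All (InS A t j) I → InS A (suc t) j u
    S-suc⁺ u I hA hI = sumAll-pos⁺ a _ I
      (subst (λ blocks → 0 < A (u ∷ I) * prodVec (zipWith entry I blocks))
             (sym (chunks-replicate a (a ^ t) j))
             (*-pos⁺ hA (prod-pos⁺ entry I (replicate (a ^ t) j) hI)))

    S-suc-diag : ∀ u w → 0 < majM A u w → InS A t j w → InS A (suc t) j u
    S-suc-diag u w hA hw = S-suc⁺ u (replicate a w) hA (all-replicate a)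
      where
        all-replicate : ∀ k → All (InS A t j) (replicate k w)
        all-replicate zero = []
        all-replicate (suc k) = hw ∷ all-replicate k

  S-zero⁻ : ∀ {n a} (A : Tensor n (suc a)) {j u : Fin n} → InS A 0 j u → u ≡ j
  S-zero⁻ A {j} {u} h with u ≟ j
  ... | yes u≡j = u≡j
  ... | no _ with () ← h

  S-zero⁺ : ∀ {n a} (A : Tensor n (suc a)) (j : Fin n) → InS A 0 j j
  S-zero⁺ A j with j ≟ j
  ... | yes _ = s≤s z≤n
  ... | no j≢j = contradiction refl j≢j

open TensorPowers

module Congruence (n : ℕ) where

  open import Data.Nat.Properties using (≤-total; m∸n≡0⇒m≤n; ≤-antisym; ≤-<-trans; m∸n≤m)
  open import Data.Nat.Divisibility using (>⇒∤) renaming (_∣_ to _∣ℕ_)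
  open import Data.Integer using (ℤ; ∣_∣; +_; 0ℤ; 1ℤ; _+_; _-_; -_; _*_)
  open import Data.Integer.Properties using (m-n≡m⊖n; ∣⊖∣-≤; *-identityˡ; *-zeroˡ; +-inverseʳ)
  open import Data.Integer.Divisibility.Signed using (_∣_; divides; ∣m⇒∣-m; ∣m∣n⇒∣m+n; ∣⇒∣ᵤ)
  open import Data.Integer.DivMod using (_%ℕ_; _/ℕ_; n%ℕd<d; a≡a%ℕn+[a/ℕn]*n)
  open import Data.Integer.Tactic.RingSolver using (solve-∀)
  open import Relation.Binary.Bundles using (Setoid)
  open import Relation.Binary.Structures using (IsEquivalence)
  import Relation.Binary.Reasoning.Setoid

  infix 4 _≋_
  record _≋_ (x y : ℤ) : Set where
    constructor divides-difference
    field n∣x-y : + n ∣ (x - y)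
  open _≋_ using (n∣x-y)

  ≋-refl : ∀ {x} → x ≋ x
  ≋-refl {x} = divides-difference (divides 0ℤ (trans (+-inverseʳ x) (sym (*-zeroˡ (+ n)))))

  ≋-sym : ∀ {x y} → x ≋ y → y ≋ x
  ≋-sym {x} {y} (divides-difference h) = divides-difference (subst (+ n ∣_) (swap x y) (∣m⇒∣-m h))
    where swap : ∀ x y → - (x - y) ≡ y - x
          swap = solve-∀

  ≋-trans : ∀ {x y z} → x ≋ y → y ≋ z → x ≋ z
  ≋-trans {x} {y} {z} (divides-difference h) (divides-difference h') =
    divides-difference (subst (+ n ∣_) (telescope x y z) (∣m∣n⇒∣m+n h h'))
    where telescope : ∀ x y z → (x - y) + (y - z) ≡ x - z
          telescope = solve-∀

  ≋-isEquivalence : IsEquivalence _≋_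
  ≋-isEquivalence = record { refl = ≋-refl ; sym = ≋-sym ; trans = ≋-trans }

  ≋-setoid : Setoid _ _
  ≋-setoid = record { isEquivalence = ≋-isEquivalence }

  module ≋-Reasoning = Relation.Binary.Reasoning.Setoid ≋-setoid

  ≋-reflexive : ∀ {x y} → x ≡ y → x ≋ y
  ≋-reflexive refl = ≋-refl

  ≋-+ : ∀ {x x' y y'} → x ≋ x' → y ≋ y' → x + y ≋ x' + y'
  ≋-+ {x} {x'} {y} {y'} (divides-difference h) (divides-difference h') =
    divides-difference (subst (+ n ∣_) (regroup x x' y y') (∣m∣n⇒∣m+n h h'))
    where regroup : ∀ x x' y y' → (x - x') + (y - y') ≡ (x + y) - (x' + y')
          regroup = solve-∀

  ≋-+ʳ : ∀ {x x'} → x ≋ x' → ∀ z → x + z ≋ x' + z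
  ≋-+ʳ h z = ≋-+ h (≋-refl {z})

  ≋-cancelʳ : ∀ {x y} z → x + z ≋ y + z → x ≋ y
  ≋-cancelʳ {x} {y} z (divides-difference h) = divides-difference (subst (+ n ∣_) (cancel x y z) h)
    where cancel : ∀ x y z → (x + z) - (y + z) ≡ x - y
          cancel = solve-∀

  ≋-cancelˡ : ∀ {x y} z → z + x ≋ z + y → x ≋ y
  ≋-cancelˡ {x} {y} z (divides-difference h) = divides-difference (subst (+ n ∣_) (cancel z x y) h)
    where cancel : ∀ z x y → (z + x) - (z + y) ≡ x - y
          cancel = solve-∀

  n≋0 : + n ≋ 0ℤ
  n≋0 = divides-difference (divides 1ℤ (trans (n-0 (+ n)) (sym (*-identityˡ (+ n)))))
    where n-0 : ∀ x → x - 0ℤ ≡ x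
          n-0 = solve-∀

  -- If x ≤ y < n and n divides x - y then y ≤ x, since 0 ≤ y - x < n.
  private
    below : ∀ {x y} → x ℕ.≤ y → y ℕ.< n → + x ≋ + y → y ℕ.≤ x
    below {x} {y} x≤y y<n h with y ℕ.∸ x in gap
    ... | zero  = m∸n≡0⇒m≤n gap
    ... | suc g = contradiction n∣gap (>⇒∤ (subst (ℕ._< n) gap (≤-<-trans (m∸n≤m y x) y<n)))
      where
        n∣gap : n ∣ℕ suc g
        n∣gap = subst (n ∣ℕ_) (trans (cong ∣_∣ (m-n≡m⊖n x y)) (trans (∣⊖∣-≤ x≤y) gap)) (∣⇒∣ᵤ (n∣x-y h))

  ≋-unique : ∀ {x y} → x ℕ.< n → y ℕ.< n → + x ≋ + y → x ≡ y
  ≋-unique {x} {y} x<n y<n h with ≤-total x y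
  ... | inj₁ x≤y = ≤-antisym x≤y (below x≤y y<n h)
  ... | inj₂ y≤x = sym (≤-antisym y≤x (below y≤x x<n (≋-sym h)))

  ≋-residue : .{{_ : NonZero n}} → ∀ x → ∃ λ d → d ℕ.< n × + d ≋ x
  ≋-residue x = x %ℕ n , n%ℕd<d x n ,
    divides-difference (divides (- (x /ℕ n)) (subst (λ z → + (x %ℕ n) - z ≡ - (x /ℕ n) * + n)
                                                   (sym (a≡a%ℕn+[a/ℕn]*n x n))
                                                   (peel (+ (x %ℕ n)) (x /ℕ n) (+ n))))
    where peel : ∀ a b c → a - (a + b * c) ≡ - b * c
          peel = solve-∀

  ≋-gap : .{{_ : NonZero n}} → ∀ x y → ∃ λ d → d ℕ.< n × x + + d ≋ y
  ≋-gap x y with ≋-residue (y - x)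
  ... | d , d<n , d≋y-x = d , d<n , ≋-trans (≋-+ (≋-refl {x}) d≋y-x) (≋-reflexive (cancel x y))
    where cancel : ∀ x y → x + (y - x) ≡ y
          cancel = solve-∀

if-pos⁻ : ∀ b → 0 < (if b then 1 else 0) → T b
if-pos⁻ true _ = tt

if-pos⁺ : ∀ b → T b → 0 < (if b then 1 else 0)
if-pos⁺ true _ = s≤s z≤n

squeeze : ∀ {q δ L} → suc q ℕ.+ δ < L → L ≤ q ℕ.+ 2 → δ ≡ 0 × L ≡ q ℕ.+ 2
squeeze {q} {δ} {L} q+1+δ<L L≤q+2 = δ≡0 , ℕ.≤-antisym L≤q+2 q+2≤L
  where
    q+2≡ : q ℕ.+ 2 ≡ suc (suc q)
    q+2≡ = ℕ.+-comm q 2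
    q+2≤L : q ℕ.+ 2 ≤ L
    q+2≤L = subst (_≤ L) (sym q+2≡) (ℕ.≤-trans (s≤s (ℕ.m≤m+n (suc q) δ)) q+1+δ<L)
    δ≡0 : δ ≡ 0
    δ≡0 = ℕ.n≤0⇒n≡0 (ℕ.+-cancelˡ-≤ (suc q) δ 0 (subst (suc q ℕ.+ δ ≤_) (sym (ℕ.+-identityʳ (suc q)))
            (ℕ.≤-pred (ℕ.≤-trans q+1+δ<L (subst (L ≤_) q+2≡ L≤q+2)))))

module Cycle (n₂ : ℕ) where

  open import Data.Nat.Properties using (≡ᵇ⇒≡; ≡⇒≡ᵇ; n<1+n; <-trans)
  open import Data.Fin using (zero; suc; fromℕ; inject₁)
  open import Data.Fin.Properties using (toℕ<n; toℕ-fromℕ; toℕ-inject₁)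
  open import Data.Integer using (ℤ; +_; 0ℤ; 1ℤ; _+_)
  open import Data.Integer.Properties using (+-identityʳ; +-assoc; +-commutativeSemigroup)
  open import Data.Integer.Tactic.RingSolver using (solve-∀)
  import Data.Nat.Tactic.RingSolver
  open import Data.Bool.Properties using (T-∨; T-∧)
  open import Algebra.Properties.CommutativeSemigroup +-commutativeSemigroup using (xy∙z≈xz∙y)

  n : ℕ
  n = suc (suc n₂)

  open Congruence n public

  n₂<n : n₂ < n
  n₂<n = ℕ.≤-trans (n<1+n n₂) (ℕ.n≤1+n (suc n₂))

  ι : Fin n → ℤ
  ι v = + toℕ v

  M1-down : ∀ {v w : Fin n} → toℕ v ≡ suc (toℕ w) → 0 < M1 n v w
  M1-down {v} {w} v≡w+1 =
    if-pos⁺ _ (Equivalence.from T-∨ (inj₂ (≡⇒≡ᵇ (toℕ v) (suc (toℕ w)) v≡w+1)))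

  M1-wrap : ∀ {v w : Fin n} → toℕ v ≡ 0 → toℕ w ≡ n₂ ⊎ toℕ w ≡ suc n₂ → 0 < M1 n v w
  M1-wrap {v} {w} v≡0 w-last = if-pos⁺ _ (Equivalence.from T-∨ (inj₁ (Equivalence.from T-∧
    (≡⇒≡ᵇ (toℕ v) 0 v≡0 , Equivalence.from T-∨ (last w-last)))))
    where
      last : toℕ w ≡ n₂ ⊎ toℕ w ≡ suc n₂ → T (toℕ w ℕ.+ 2 ℕ.≡ᵇ n) ⊎ T (toℕ w ℕ.+ 1 ℕ.≡ᵇ n)
      last (inj₁ e) = inj₁ (≡⇒≡ᵇ _ _ (trans (ℕ.+-comm (toℕ w) 2) (cong (2 ℕ.+_) e)))
      last (inj₂ e) = inj₂ (≡⇒≡ᵇ _ _ (trans (ℕ.+-comm (toℕ w) 1) (cong suc e)))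

  M1-edge⁻ : ∀ (v w : Fin n) → 0 < M1 n v w → ι v ≋ ι w + 1ℤ ⊎ (toℕ v ≡ 0 × toℕ w ≡ n₂)
  M1-edge⁻ v w pos with Equivalence.to T-∨ (if-pos⁻ _ pos)
  ... | inj₂ down = inj₁ (≋-reflexive (cong +_ (trans (≡ᵇ⇒≡ _ _ down) (ℕ.+-comm 1 (toℕ w)))))
  ... | inj₁ wrap with Equivalence.to T-∧ wrap
  ...   | v≡0 , last with Equivalence.to T-∨ last
  ...     | inj₁ w+2≡n = inj₂ (≡ᵇ⇒≡ _ _ v≡0 , ℕ.+-cancelʳ-≡ 2 (toℕ w) n₂ (trans (≡ᵇ⇒≡ _ _ w+2≡n) (ℕ.+-comm 2 n₂)))
  ...     | inj₂ w+1≡n = inj₁ (subst₂ _≋_ (cong +_ (sym (≡ᵇ⇒≡ _ _ v≡0))) (cong +_ (sym (≡ᵇ⇒≡ _ _ w+1≡n))) (≋-sym n≋0))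

  M1-pred : ∀ (v : Fin n) → ∃ λ w → 0 < M1 n v w × ι w + 1ℤ ≋ ι v
  M1-pred zero = fromℕ (suc n₂) , M1-wrap refl (inj₂ (toℕ-fromℕ (suc n₂))) ,
    subst (λ z → + z + 1ℤ ≋ 0ℤ) (sym (toℕ-fromℕ (suc n₂))) (subst (_≋ 0ℤ) (cong +_ (ℕ.+-comm 1 (suc n₂))) n≋0)
  M1-pred (suc y) = inject₁ y , M1-down (cong suc (sym (toℕ-inject₁ y))) ,
    ≋-reflexive (cong +_ (trans (ℕ.+-comm (toℕ (inject₁ y)) 1) (cong suc (toℕ-inject₁ y))))

  open ≋-Reasoning

  +n≋ : ∀ x → x + + n ≋ x
  +n≋ x = ≋-trans (≋-+ (≋-refl {x}) n≋0) (≋-reflexive (+-identityʳ x))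

  -- The arc of length L ending at e: the residues e, e - 1, …, e - (L - 1).
  record Arc (e : ℤ) (L : ℕ) (v : Fin n) : Set where
    constructor arc
    field
      offset   : ℕ
      offset<L : offset < L
      reaches  : ι v + + offset ≋ e

  -- Vertices with an M₁-edge into S; S_{t+1}(A₀) = Pre (S_t(A₀)).
  record Pre (S : Fin n → Set) (v : Fin n) : Set where
    constructor pre
    field
      target : Fin n
      edge   : 0 < M1 n v target
      lands  : S target

  Pre-mono : ∀ {S S' : Fin n → Set} → S ⊆ S' → Pre S ⊆ Pre S'
  Pre-mono S⊆S' (pre w edge w∈S) = pre w edge (S⊆S' w∈S)

  Pre-cong : ∀ {S S' : Fin n → Set} → S ≐ S' → Pre S ≐ Pre S'
  Pre-cong (S⊆S' , S'⊆S) = Pre-mono S⊆S' , Pre-mono S'⊆S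

  -- Shifting an arc by one: Arc (e + 1) L ⊆ Pre (Arc e L), with equality unless
  -- e ≡ n - 2, where the chord 0 → n - 2 makes the arc grow by one.
  Arc-shift⊆Pre : ∀ {e L} → Arc (e + 1ℤ) L ⊆ Pre (Arc e L)
  Arc-shift⊆Pre {e} {L} {v} (arc d d<L v+d≋e+1) with M1-pred v
  ... | w , edge , w+1≋v = pre w edge (arc d d<L (≋-cancelʳ 1ℤ (begin
        (ι w + + d) + 1ℤ  ≡⟨ xy∙z≈xz∙y (ι w) (+ d) 1ℤ ⟩
        (ι w + 1ℤ) + + d  ≈⟨ ≋-+ʳ w+1≋v (+ d) ⟩
        ι v + + d         ≈⟨ v+d≋e+1 ⟩
        e + 1ℤ            ∎)))

  Pre⊆Arc-shift : ∀ {e L} → ¬ (+ n₂ ≋ e) → Pre (Arc e L) ⊆ Arc (e + 1ℤ) L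
  Pre⊆Arc-shift {e} {L} ¬chord {v} (pre w edge (arc d d<L w+d≋e)) with M1-edge⁻ v w edge
  ... | inj₁ v≋w+1 = arc d d<L (begin
        ι v + + d         ≈⟨ ≋-+ʳ v≋w+1 (+ d) ⟩
        (ι w + 1ℤ) + + d  ≡⟨ xy∙z≈xz∙y (ι w) 1ℤ (+ d) ⟩
        (ι w + + d) + 1ℤ  ≈⟨ ≋-+ʳ w+d≋e 1ℤ ⟩
        e + 1ℤ            ∎)
  ... | inj₂ (v≡0 , w≡n₂) with d | w+d≋e
  ...   | zero | w≋e = contradiction (subst (λ z → + z + 0ℤ ≋ e) w≡n₂ w≋e)
                         (λ h → ¬chord (≋-trans (≋-reflexive (sym (+-identityʳ (+ n₂)))) h))
  ...   | suc d' | w+d≋e' = arc d' (<-trans (n<1+n d') d<L) (begin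
        ι v + + d'                ≡⟨ cong (λ z → + z + + d') v≡0 ⟩
        + d'                      ≈⟨ ≋-sym (+n≋ (+ d')) ⟩
        + (d' ℕ.+ n)              ≡⟨ cong +_ (wrap d' n₂) ⟩
        + (n₂ ℕ.+ suc d') + 1ℤ    ≡⟨ cong (λ z → + (z ℕ.+ suc d') + 1ℤ) (sym w≡n₂) ⟩
        (ι w + + suc d') + 1ℤ     ≈⟨ ≋-+ʳ w+d≋e' 1ℤ ⟩
        e + 1ℤ                    ∎)
    where
      wrap : ∀ d m → d ℕ.+ suc (suc m) ≡ (m ℕ.+ suc d) ℕ.+ 1
      wrap = Data.Nat.Tactic.RingSolver.solve-∀

  Arc-≋ : ∀ {e e' L} → e ≋ e' → Arc e L ⊆ Arc e' L
  Arc-≋ e≋e' (arc d d<L v+d≋e) = arc d d<L (≋-trans v+d≋e e≋e')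

  private
    -- (a + 1) + (1 + d) = (a + d) + 2, with 1 abstracted as c.
    regroup : ∀ a c d → (a + c) + (c + d) ≡ (a + d) + (c + c)
    regroup = solve-∀

    n≡n₂+2 : + n ≡ + n₂ + + 2
    n≡n₂+2 = cong +_ (ℕ.+-comm 2 n₂)

  penultimate : Fin n
  penultimate = inject₁ (fromℕ n₂)

  toℕ-penultimate : toℕ penultimate ≡ n₂
  toℕ-penultimate = trans (toℕ-inject₁ (fromℕ n₂)) (toℕ-fromℕ n₂)

  Pre⊆Arc-wrap : ∀ {L} → Pre (Arc (+ n₂) L) ⊆ Arc 0ℤ (suc L)
  Pre⊆Arc-wrap {L} {v} (pre w edge (arc d d<L w+d≋n₂)) with M1-edge⁻ v w edge
  ... | inj₁ v≋w+1 = arc (suc d) (s≤s d<L) (begin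
        ι v + + suc d              ≈⟨ ≋-+ʳ v≋w+1 (+ suc d) ⟩
        (ι w + 1ℤ) + (1ℤ + + d)    ≡⟨ regroup (ι w) 1ℤ (+ d) ⟩
        (ι w + + d) + + 2          ≈⟨ ≋-+ʳ w+d≋n₂ (+ 2) ⟩
        + n₂ + + 2                 ≡⟨ sym n≡n₂+2 ⟩
        + n                        ≈⟨ n≋0 ⟩
        0ℤ                         ∎)
  ... | inj₂ (v≡0 , _) = arc 0 (s≤s z≤n) (≋-reflexive (cong (λ z → + z + 0ℤ) v≡0))

  Arc-wrap⊆Pre : ∀ {L} → 0 < L → Arc 0ℤ (suc L) ⊆ Pre (Arc (+ n₂) L)
  Arc-wrap⊆Pre {L} 0<L {v} (arc zero _ v+0≋0) =
    pre penultimate (M1-wrap v≡0 (inj₁ toℕ-penultimate))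
        (arc 0 0<L (≋-reflexive (trans (+-identityʳ _) (cong +_ toℕ-penultimate))))
    where
      v≡0 : toℕ v ≡ 0
      v≡0 = ≋-unique (toℕ<n v) (s≤s z≤n) (subst (_≋ 0ℤ) (+-identityʳ (ι v)) v+0≋0)
  Arc-wrap⊆Pre {L} 0<L {v} (arc (suc d) (s≤s d<L) v+d≋0) with M1-pred v
  ... | w , edge , w+1≋v = pre w edge (arc d d<L (≋-cancelʳ (+ 2) (begin
        (ι w + + d) + + 2          ≡⟨ sym (regroup (ι w) 1ℤ (+ d)) ⟩
        (ι w + 1ℤ) + (1ℤ + + d)    ≈⟨ ≋-+ʳ w+1≋v (+ suc d) ⟩
        ι v + + suc d              ≈⟨ v+d≋0 ⟩
        0ℤ                         ≈⟨ ≋-sym n≋0 ⟩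
        + n                        ≡⟨ n≡n₂+2 ⟩
        + n₂ + + 2                 ∎)))

  -- If a and b ≡ a + q + 1 both lie on Arc e L with L ≤ q + 2 ≤ n, and b has offset δ
  -- with q + 1 + δ < n, then the arc is the full one of length q + 2 ending at b:
  -- the offsets of a and b must differ by exactly q + 1 < L.
  full-arc-at : ∀ {q e L δ} {a b : Fin n} → q ℕ.+ 2 ≤ n → L ≤ q ℕ.+ 2 → ι a + + suc q ≋ ι b →
    Arc e L a → ι b + + δ ≋ e → suc q ℕ.+ δ < n → L ≡ q ℕ.+ 2 × ι b ≋ e
  full-arc-at {q} {e} {L} {δ} {a} {b} q+2≤n L≤q+2 a+q+1≋b (arc δa δa<L a+δa≋e) b+δ≋e q+1+δ<n =
    L≡q+2 , ≋-trans (≋-reflexive (sym (+-identityʳ (ι b)))) (subst (λ z → ι b + + z ≋ e) δ≡0 b+δ≋e)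
    where
      δa≋q+1+δ : + δa ≋ + (suc q ℕ.+ δ)
      δa≋q+1+δ = ≋-cancelˡ (ι a) (begin
        ι a + + δa                 ≈⟨ a+δa≋e ⟩
        e                          ≈⟨ ≋-sym b+δ≋e ⟩
        ι b + + δ                  ≈⟨ ≋-+ʳ (≋-sym a+q+1≋b) (+ δ) ⟩
        (ι a + + suc q) + + δ      ≡⟨ +-assoc (ι a) (+ suc q) (+ δ) ⟩
        ι a + + (suc q ℕ.+ δ)      ∎)
      q+1+δ<L : suc q ℕ.+ δ < L
      q+1+δ<L = subst (_< L) (≋-unique (ℕ.<-≤-trans δa<L (ℕ.≤-trans L≤q+2 q+2≤n)) q+1+δ<n δa≋q+1+δ) δa<L
      δ≡0 : δ ≡ 0
      δ≡0 = proj₁ (squeeze q+1+δ<L L≤q+2)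
      L≡q+2 : L ≡ q ℕ.+ 2
      L≡q+2 = proj₂ (squeeze q+1+δ<L L≤q+2)

  -- Let b ≡ a + q + 1, so that the block {a+1, …, b+1} is the
  -- arc of length q + 2 ending at b + 1, and let a and b lie on an arc Arc e L with
  -- L ≤ q + 2 that is not the arc of length q + 2 ending at b.  Then every vertex x
  -- outside the block lies on the shifted arc Arc (e + 1) L.  (Write x + d ≡ e + 1 with
  -- d < n; if d ≥ L then x + (d - δ) ≡ b + 1, so d - δ ≥ q + 2 and full-arc-at applies.)
  outside-block : ∀ {q e L} {a b x : Fin n} → q ℕ.+ 2 ≤ n → L ≤ q ℕ.+ 2 →
    ¬ (L ≡ q ℕ.+ 2 × ι b ≋ e) → ι a + + suc q ≋ ι b →
    Arc e L a → Arc e L b → ¬ Arc (ι b + 1ℤ) (q ℕ.+ 2) x → Arc (e + 1ℤ) L x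
  outside-block {q} {e} {L} {a} {b} {x} q+2≤n L≤q+2 ¬full a+q+1≋b a∈arc (arc δ δ<L b+δ≋e) x∉block
    with ≋-gap (ι x) (e + 1ℤ)
  ... | d , d<n , x+d≋e+1 with d ℕ.<? L
  ...   | yes d<L = arc d d<L x+d≋e+1
  ...   | no d≮L with (d ℕ.∸ δ) ℕ.<? q ℕ.+ 2
  ...     | yes g<q+2 = contradiction (arc (d ℕ.∸ δ) g<q+2 x+g≋b+1) x∉block
    where
      d≡g+δ : d ≡ (d ℕ.∸ δ) ℕ.+ δ
      d≡g+δ = sym (ℕ.m∸n+n≡m (ℕ.<⇒≤ (ℕ.<-≤-trans δ<L (ℕ.≮⇒≥ d≮L))))
      x+g≋b+1 : ι x + + (d ℕ.∸ δ) ≋ ι b + 1ℤ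
      x+g≋b+1 = ≋-cancelʳ (+ δ) (begin
        (ι x + + (d ℕ.∸ δ)) + + δ  ≡⟨ +-assoc (ι x) (+ (d ℕ.∸ δ)) (+ δ) ⟩
        ι x + + ((d ℕ.∸ δ) ℕ.+ δ)  ≡⟨ cong (λ z → ι x + + z) (sym d≡g+δ) ⟩
        ι x + + d                  ≈⟨ x+d≋e+1 ⟩
        e + 1ℤ                     ≈⟨ ≋-+ʳ (≋-sym b+δ≋e) 1ℤ ⟩
        (ι b + + δ) + 1ℤ           ≡⟨ xy∙z≈xz∙y (ι b) (+ δ) 1ℤ ⟩
        (ι b + 1ℤ) + + δ           ∎)
  ...     | no g≮q+2 = contradiction (full-arc-at q+2≤n L≤q+2 a+q+1≋b a∈arc b+δ≋e q+1+δ<n) ¬full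
    where
      -- q + 1 + δ < q + 2 + δ ≤ (d - δ) + δ = d < n
      q+1+δ<n : suc q ℕ.+ δ < n
      q+1+δ<n = ℕ.<-≤-trans (ℕ.+-monoˡ-< δ (subst (suc q <_) (ℕ.+-comm 2 q) (ℕ.n<1+n (suc q))))
                  (ℕ.≤-trans (ℕ.+-monoˡ-≤ δ (ℕ.≮⇒≥ g≮q+2))
                    (ℕ.≤-trans (ℕ.≤-reflexive (ℕ.m∸n+n≡m (ℕ.<⇒≤ (ℕ.<-≤-trans δ<L (ℕ.≮⇒≥ d≮L)))))
                      (ℕ.<⇒≤ d<n)))

if-pos-split : ∀ b {x y} → 0 < (if b then x else y) → 0 < x ⊎ 0 < y
if-pos-split true h = inj₁ h
if-pos-split false h = inj₂ h

-- The tensors A₀ and A_k of order m = m' + 2 and dimension n = n₂ + 2, with r = r' + 1.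
module Entries (m' n₂ q r' : ℕ) where

  import Data.Vec.Relation.Unary.All as VecAll
  open import Data.Vec.Relation.Unary.All.Properties using (toList⁺)
  import Data.List as List
  open import Data.List.Relation.Unary.All using (lookupAny)
  import Data.List.Relation.Unary.Any as Any
  open import Data.List.Relation.Unary.Any.Properties using (any⁺; any⁻)
  open import Data.List.Membership.Propositional using (lose)
  open import Data.List.Membership.Propositional.Properties using (∈-upTo⁺)
  open import Data.Bool using (not; _∨_)
  open import Data.Bool.ListAction using (any; all)
  open import Function.Base using (_∘_)
  open import Data.Bool.Properties using (T-∧)
  open import Data.Integer using (ℤ; +_; 1ℤ; _+_; _-_)
  open import Data.Integer.Properties using (+-comm)
  open import Data.Integer.Tactic.RingSolver using (solve-∀)
  open import Data.Integer.Divisibility.Signed using (∣ᵤ⇒∣; ∣⇒∣ᵤ)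
  open import Relation.Nullary.Decidable using (toWitness; fromWitness)

  open Cycle n₂ public

  m r : ℕ
  m = suc (suc m')
  r = suc r'

  A₀ Aₖ : Tensor n (suc (suc m'))
  A₀ = A0 m n
  Aₖ = Ak m n q r

  -- The two residues whose joint occurrence switches on the extra entries of A_k:
  -- |r - q - 1|_n and |r|_n (in the paper's 1-based indexing).
  Xa Xb : ℤ
  Xa = (+ r - + q) - + 1
  Xb = + r

  allEq-replicate : ∀ k (v : Fin n) → allEq v (toList (replicate k v)) ≡ true
  allEq-replicate zero v = refl
  allEq-replicate (suc k) v with v ≟ v
  ... | yes _ = allEq-replicate k v
  ... | no v≢v = contradiction refl v≢v

  A₀-diag : ∀ u v → majM A₀ u v ≡ M1 n u v
  A₀-diag u v rewrite allEq-replicate m' v = refl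

  Aₖ-diag : ∀ u v → majM Aₖ u v ≡ M1 n u v
  Aₖ-diag u v rewrite allEq-replicate m' v = refl

  A₀-support : ∀ u v rest → 0 < A₀ (u ∷ v ∷ rest) → 0 < M1 n u v
  A₀-support u v rest pos with if-pos-split (allEq v (toList rest)) pos
  ... | inj₁ edge = edge
  ... | inj₂ ()

  Aₖ-support : ∀ u v rest → 0 < Aₖ (u ∷ v ∷ rest) →
    0 < M1 n u v ⊎ (¬ T (inBlock n q r u) × T (valsEq n Xa Xb (toList (v ∷ rest))))
  Aₖ-support u v rest pos with if-pos-split (allEq v (toList rest)) pos
  ... | inj₁ edge = inj₁ edge
  ... | inj₂ extra with Equivalence.to T-∧ (if-pos⁻ _ extra)
  ...   | outside , vals = inj₂ (not-T outside , vals)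
    where
      not-T : ∀ {b} → T (not b) → ¬ T b
      not-T {false} _ ()

  isAbs⁻ : ∀ (u : Fin n) X → T (isAbs n u X) → + suc (toℕ u) ≋ X
  isAbs⁻ u X h = divides-difference (∣ᵤ⇒∣ (toWitness h))

  isAbs⁺ : ∀ (u : Fin n) X → + suc (toℕ u) ≋ X → T (isAbs n u X)
  isAbs⁺ u X (divides-difference h) = fromWitness (∣⇒∣ᵤ h)

  valsEq⁻ : ∀ X Y (xs : List.List (Fin n)) → T (valsEq n X Y xs) →
    T (any (λ v → isAbs n v X) xs) × T (any (λ v → isAbs n v Y) xs)
  valsEq⁻ X Y xs h = Equivalence.to T-∧ (proj₂ (Equivalence.to (T-∧ {all (λ v → isAbs n v X ∨ isAbs n v Y) xs}) h))

  pick : ∀ {P : Fin n → Set} {k} {I : Vec (Fin n) k} (f : Fin n → Bool) →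
    VecAll.All P I → T (any f (toList I)) → ∃ λ x → P x × T (f x)
  pick {I = I} f all-P some-f = Any.lookup found , lookupAny (toList⁺ all-P) found
    where
      found : Any.Any (T ∘ f) (toList I)
      found = any⁻ f (toList I) some-f

  Xa-Xb-gap : ∀ {a b : Fin n} → T (isAbs n a Xa) → T (isAbs n b Xb) → ι a + + suc q ≋ ι b
  Xa-Xb-gap {a} {b} a≋Xa b≋Xb = ≋-cancelʳ 1ℤ (begin
      (ι a + + suc q) + 1ℤ      ≡⟨ shuffle (ι a) (+ q) 1ℤ ⟩
      (1ℤ + ι a) + (1ℤ + + q)   ≈⟨ ≋-+ʳ (isAbs⁻ a Xa a≋Xa) (+ suc q) ⟩
      Xa + (1ℤ + + q)           ≡⟨ telescope (+ r) (+ q) 1ℤ ⟩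
      + r                       ≈⟨ ≋-sym (isAbs⁻ b Xb b≋Xb) ⟩
      1ℤ + ι b                  ≡⟨ +-comm 1ℤ (ι b) ⟩
      ι b + 1ℤ                  ∎)
    where
      open ≋-Reasoning
      shuffle : ∀ a q c → (a + (c + q)) + c ≡ (c + a) + (c + q)
      shuffle = solve-∀
      telescope : ∀ r q c → ((r - q) - c) + (c + q) ≡ r
      telescope = solve-∀

  inBlock⁺ : ∀ {b x : Fin n} → T (isAbs n b Xb) → Arc (ι b + 1ℤ) (q ℕ.+ 2) x → T (inBlock n q r x)
  inBlock⁺ {b} {x} b≋Xb (arc d d<q+2 x+d≋b+1) =
    any⁺ (λ s → isAbs n x ((+ r - + q) + + s)) (lose (∈-upTo⁺ s<q+2) (isAbs⁺ x ((+ r - + q) + + s) (≋-cancelʳ (+ d) (begin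
      (1ℤ + ι x) + + d            ≡⟨ shuffle (ι x) (+ d) 1ℤ ⟩
      (ι x + + d) + 1ℤ            ≈⟨ ≋-+ʳ x+d≋b+1 1ℤ ⟩
      (ι b + 1ℤ) + 1ℤ             ≡⟨ cong (_+ 1ℤ) (+-comm (ι b) 1ℤ) ⟩
      (1ℤ + ι b) + 1ℤ             ≈⟨ ≋-+ʳ (isAbs⁻ b Xb b≋Xb) 1ℤ ⟩
      + r + 1ℤ                    ≡⟨ rebalance (+ r) (+ q) (+ s) (+ d) 1ℤ s+d≡q+1 ⟩
      ((+ r - + q) + + s) + + d   ∎))))
    where
      open ≋-Reasoning
      d≤q+1 : d ≤ q ℕ.+ 1
      d≤q+1 = ℕ.≤-pred (subst (d <_) (ℕ.+-suc q 1) d<q+2)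
      s : ℕ
      s = (q ℕ.+ 1) ℕ.∸ d
      s<q+2 : s < q ℕ.+ 2
      s<q+2 = ℕ.≤-<-trans (ℕ.m∸n≤m (q ℕ.+ 1) d) (subst (q ℕ.+ 1 <_) (sym (ℕ.+-suc q 1)) (ℕ.n<1+n (q ℕ.+ 1)))
      s+d≡q+1 : + s + + d ≡ + q + 1ℤ
      s+d≡q+1 = cong +_ (ℕ.m∸n+n≡m d≤q+1)
      shuffle : ∀ x d c → (c + x) + d ≡ (x + d) + c
      shuffle = solve-∀
      rebalance : ∀ r q s d c → s + d ≡ q + c → r + c ≡ ((r - q) + s) + d
      rebalance r q s d c e = trans (solve-r r q c) (trans (cong (λ z → (r - q) + z) (sym e)) (solve-s r q s d))
        where
          solve-r : ∀ r q c → r + c ≡ (r - q) + (q + c)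
          solve-r = solve-∀
          solve-s : ∀ r q s d → (r - q) + (s + d) ≡ ((r - q) + s) + d
          solve-s = solve-∀

open import Data.Nat using (_+_; _*_; _∸_)
open import Data.Nat.DivMod using (_%_; _/_; m≡m%n+[m/n]*n; m%n<n)
open import Data.Fin.Properties using (toℕ-injective; toℕ<n)
import Data.Vec.Relation.Unary.All as VecAll
open import Data.Integer using (+_; 1ℤ) renaming (_+_ to _+ℤ_)
import Data.Integer.Properties
import Data.Nat.Tactic.RingSolver
open import Relation.Unary.Properties using (≐-trans)
open import Data.Bool.ListAction using (any)

digits-< : ∀ {N e e' p p'} → e' < N → e + p * N < e' + p' * N → p ≤ p' × (p ≡ p' → e < e')
digits-< {N} {e} {e'} {p} {p'} e'<N lt = p≤p' , λ { refl → ℕ.+-cancelʳ-< (p * N) e e' lt }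
  where
    p≤p' : p ≤ p'
    p≤p' with p ℕ.≤? p'
    ... | yes p≤p' = p≤p'
    ... | no p≰p' = contradiction lt (ℕ.<-asym (begin-strict
          e' + p' * N   <⟨ ℕ.+-monoˡ-< (p' * N) e'<N ⟩
          suc p' * N    ≤⟨ ℕ.*-monoˡ-≤ N (ℕ.≰⇒> p≰p') ⟩
          p * N         ≤⟨ ℕ.m≤n+m (p * N) e ⟩
          e + p * N     ∎))
      where open ℕ.≤-Reasoning

module Agreement (m' n₂ q r' : ℕ) (j : Fin (suc (suc n₂))) (j≡n-2 : toℕ j ≡ n₂)
                 (q≤n₂ : q ≤ n₂) (r'≤n₂ : r' ≤ n₂) where

  open Entries m' n₂ q r'

  N k : ℕ
  N = suc n₂
  k = N * q + r

  S₀ Sₖ : ℕ → Fin n → Set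
  S₀ t = InS A₀ t j
  Sₖ t = InS Aₖ t j

  S₀-zero : S₀ 0 ≐ Arc (+ n₂) 1
  S₀-zero = (λ u∈S₀ → at-j (S-zero⁻ A₀ u∈S₀)) , on-arc
    where
      at-j : ∀ {u} → u ≡ j → Arc (+ n₂) 1 u
      at-j refl = arc 0 (s≤s z≤n) (≋-reflexive (trans (Data.Integer.Properties.+-identityʳ _) (cong +_ j≡n-2)))
      on-arc : Arc (+ n₂) 1 ⊆ S₀ 0
      on-arc {u} (arc zero _ u≋n-2) = subst (S₀ 0) (sym (toℕ-injective (trans u≡n-2 (sym j≡n-2)))) (S-zero⁺ A₀ j)
        where
          u≡n-2 : toℕ u ≡ n₂
          u≡n-2 = ≋-unique (toℕ<n u) n₂<n (subst (_≋ + n₂) (Data.Integer.Properties.+-identityʳ _) u≋n-2)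
      on-arc (arc (suc _) (s≤s ()) _)

  -- Since A₀ only has diagonal entries, S_{t+1}(A₀) = Pre (S_t(A₀)).
  S₀-suc : ∀ t → S₀ (suc t) ≐ Pre (S₀ t)
  S₀-suc t = from-entry , to-entry
    where
      from-entry : S₀ (suc t) ⊆ Pre (S₀ t)
      from-entry {u} h with S-suc⁻ A₀ t j u h
      ... | v ∷ rest , pos , v∈S₀ VecAll.∷ _ = pre v (A₀-support u v rest pos) v∈S₀
      to-entry : Pre (S₀ t) ⊆ S₀ (suc t)
      to-entry {u} (pre w edge w∈S₀) = S-suc-diag A₀ t j u w (subst (0 <_) (sym (A₀-diag u w)) edge) w∈S₀

  S₀-arc : ∀ p e → e ≤ n₂ → S₀ (suc (e + p * N)) ≐ Arc (+ e) (2 + p)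
  S₀-arc zero zero _ =
    ≐-trans (S₀-suc 0) (≐-trans (Pre-cong S₀-zero) (Pre⊆Arc-wrap , Arc-wrap⊆Pre (s≤s z≤n)))
  S₀-arc (suc p) zero _ =
    ≐-trans (S₀-suc (suc (n₂ + p * N))) (≐-trans (Pre-cong (S₀-arc p n₂ ℕ.≤-refl)) (Pre⊆Arc-wrap , Arc-wrap⊆Pre (s≤s z≤n)))
  S₀-arc p (suc e) e<n₂ =
    ≐-trans (S₀-suc (suc (e + p * N))) (≐-trans (Pre-cong (S₀-arc p e (ℕ.<⇒≤ e<n₂)))
      ((λ h → Arc-≋ e+1≋ (Pre⊆Arc-shift not-chord h)) , (λ h → Arc-shift⊆Pre (Arc-≋ (≋-sym e+1≋) h))))
    where
      e+1≋ : + e +ℤ 1ℤ ≋ + suc e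
      e+1≋ = ≋-reflexive (cong +_ (ℕ.+-comm e 1))
      not-chord : ¬ (+ n₂ ≋ + e)
      not-chord n₂≋e = ℕ.<-irrefl (≋-unique (ℕ.≤-<-trans (ℕ.<⇒≤ e<n₂) n₂<n) n₂<n (≋-sym n₂≋e)) e<n₂

  record ArcBound (t : ℕ) : Set where
    field
      end len    : ℕ
      end≤n₂     : end ≤ n₂
      S₀≐arc     : S₀ t ≐ Arc (+ end) len
      len≤q+2    : len ≤ q + 2
      full⇒early : len ≡ q + 2 → end < r'

  arc-bound : ∀ t → t < k → ArcBound t
  arc-bound zero _ = record
    { end = n₂ ; len = 1 ; end≤n₂ = ℕ.≤-refl ; S₀≐arc = S₀-zero
    ; len≤q+2 = ℕ.≤-trans (s≤s z≤n) (ℕ.m≤n+m 2 q)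
    ; full⇒early = λ 1≡q+2 → contradiction (trans 1≡q+2 (ℕ.+-comm q 2)) λ () }
  arc-bound (suc t) t+1<k = record
    { end = e ; len = 2 + p ; end≤n₂ = ℕ.≤-pred (m%n<n t N)
    ; S₀≐arc = subst (λ z → S₀ (suc z) ≐ Arc (+ e) (2 + p)) (sym t≡e+pN) (S₀-arc p e (ℕ.≤-pred (m%n<n t N)))
    ; len≤q+2 = subst (2 + p ≤_) (ℕ.+-comm 2 q) (ℕ.+-monoʳ-≤ 2 (proj₁ digits))
    ; full⇒early = λ 2+p≡q+2 → proj₂ digits (ℕ.+-cancelˡ-≡ 2 p q (trans 2+p≡q+2 (ℕ.+-comm q 2))) }
    where
      e p : ℕ
      e = t % N
      p = t / N
      t≡e+pN : t ≡ e + p * N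
      t≡e+pN = m≡m%n+[m/n]*n t N
      -- t < k - 1 = r' + q (n - 1), read digitwise.
      digits : p ≤ q × (p ≡ q → e < r')
      digits = digits-< (s≤s r'≤n₂) (subst₂ _<_ t≡e+pN (trans (ℕ.+-comm (N * q) r') (cong (λ z → r' + z) (ℕ.*-comm N q)))
                          (ℕ.≤-pred (subst (suc (suc t) ≤_) (ℕ.+-suc (N * q) r') t+1<k)))

  q+2≤n : q + 2 ≤ n
  q+2≤n = subst (q + 2 ≤_) (ℕ.+-comm n₂ 2) (ℕ.+-monoˡ-≤ 2 q≤n₂)

  extra-entry-harmless : ∀ t → t < k → ∀ {u} {I : Vec (Fin n) (suc m')} → VecAll.All (S₀ t) I →
    ¬ T (inBlock n q r u) → T (valsEq n Xa Xb (toList I)) → S₀ (suc t) u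
  extra-entry-harmless t t<k {u} {I} I⊆S₀ u∉block vals =
    proj₂ (S₀-suc t) (Pre-mono (proj₂ S₀≐arc) (Arc-shift⊆Pre u-on-shifted-arc))
    where
      open ArcBound (arc-bound t t<k)
      occurrences : T (any (λ v → isAbs n v Xa) (toList I)) × T (any (λ v → isAbs n v Xb) (toList I))
      occurrences = valsEq⁻ Xa Xb (toList I) vals
      a-found : ∃ λ a → S₀ t a × T (isAbs n a Xa)
      a-found = pick (λ v → isAbs n v Xa) I⊆S₀ (proj₁ occurrences)
      b-found : ∃ λ b → S₀ t b × T (isAbs n b Xb)
      b-found = pick (λ v → isAbs n v Xb) I⊆S₀ (proj₂ occurrences)
      a b : Fin n
      a = proj₁ a-found
      b = proj₁ b-found
      b≋r' : ι b ≋ + r'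
      b≋r' = ≋-cancelˡ 1ℤ (isAbs⁻ b Xb (proj₂ (proj₂ b-found)))
      not-full : ¬ (len ≡ q + 2 × ι b ≋ + end)
      not-full (full , b≋end) = ℕ.<-irrefl end≡r' (full⇒early full)
        where
          end≡r' : end ≡ r'
          end≡r' = ≋-unique (ℕ.≤-<-trans end≤n₂ n₂<n) (ℕ.≤-<-trans r'≤n₂ n₂<n) (≋-trans (≋-sym b≋end) b≋r')
      u-on-shifted-arc : Arc (+ end +ℤ 1ℤ) len u
      u-on-shifted-arc = outside-block q+2≤n len≤q+2 not-full
        (Xa-Xb-gap (proj₂ (proj₂ a-found)) (proj₂ (proj₂ b-found)))
        (proj₁ S₀≐arc (proj₁ (proj₂ a-found))) (proj₁ S₀≐arc (proj₁ (proj₂ b-found)))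
        (λ in-block → u∉block (inBlock⁺ (proj₂ (proj₂ b-found)) in-block))

  agree : ∀ t → t ≤ k → Sₖ t ≐ S₀ t
  agree zero _ = (λ h → h) , (λ h → h)
  agree (suc t) t<k = Sₖ⊆S₀ , S₀⊆Sₖ
    where
      IH : Sₖ t ≐ S₀ t
      IH = agree t (ℕ.<⇒≤ t<k)
      S₀⊆Sₖ : S₀ (suc t) ⊆ Sₖ (suc t)
      S₀⊆Sₖ {u} h with proj₁ (S₀-suc t) {u} h
      ... | pre w edge w∈S₀ = S-suc-diag Aₖ t j u w (subst (0 <_) (sym (Aₖ-diag u w)) edge) (proj₂ IH w∈S₀)
      Sₖ⊆S₀ : Sₖ (suc t) ⊆ S₀ (suc t)
      Sₖ⊆S₀ {u} h with S-suc⁻ Aₖ t j u h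
      ... | v ∷ rest , pos , I⊆Sₖ with Aₖ-support u v rest pos
      ...   | inj₁ edge = proj₂ (S₀-suc t) {u} (pre v edge (proj₁ IH (VecAll.head I⊆Sₖ)))
      ...   | inj₂ (u∉block , vals) = extra-entry-harmless t t<k (VecAll.map (proj₁ IH) I⊆Sₖ) u∉block vals

-- The hypothesis k ≤ n² - 3n + 2 = (n - 1)(n - 2) with k = (n - 1) q + r, r ≥ 1, forces q < n - 2.
quotient-bound : ∀ n₂ q r' k → k ≤ (suc (suc n₂) * suc (suc n₂) + 2) ∸ 3 * suc (suc n₂) →
  k ≡ suc n₂ * q + suc r' → q ≤ n₂
quotient-bound n₂ q r' k k≤ k≡ = ℕ.<⇒≤ (ℕ.*-cancelˡ-< (suc n₂) q n₂ (begin-strict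
    suc n₂ * q             <⟨ ℕ.m<m+n (suc n₂ * q) (s≤s z≤n) ⟩
    suc n₂ * q + suc r'    ≡⟨ sym k≡ ⟩
    k                      ≤⟨ k≤ ⟩
    (n * n + 2) ∸ 3 * n  ≡⟨ cong (_∸ 3 * n) (expand n₂) ⟩
    (suc n₂ * n₂ + 3 * n) ∸ 3 * n ≡⟨ ℕ.m+n∸n≡m (suc n₂ * n₂) (3 * n) ⟩
    suc n₂ * n₂            ∎))
  where
    open ℕ.≤-Reasoning
    n : ℕ
    n = suc (suc n₂)
    expand : ∀ a → suc (suc a) * suc (suc a) + 2 ≡ suc a * a + 3 * suc (suc a)
    expand = Data.Nat.Tactic.RingSolver.solve-∀

proposition3p1 : (m n k q r : ℕ) → 2 ≤ m → 2 ≤ n →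
    1 ≤ k → k ≤ (n * n + 2) ∸ 3 * n →
    k ≡ (n ∸ 1) * q + r → 1 ≤ r → r ≤ n ∸ 1 →
    (j : Fin n) → toℕ j ≡ n ∸ 2 →
    (t : ℕ) → 1 ≤ t → t ≤ k →
    (u : Fin n) →
      (InS (Ak m n q r) t j u → InS (A0 m n) t j u) ×
      (InS (A0 m n) t j u → InS (Ak m n q r) t j u)
proposition3p1 (suc (suc m')) (suc (suc n₂)) k q (suc r') (s≤s (s≤s _)) (s≤s (s≤s _)) _ k≤ k≡ _ r≤n-1 j j≡n-2 t _ t≤k u =
  proj₁ Sₖ≐S₀ , proj₂ Sₖ≐S₀
  where
    open Agreement m' n₂ q r' j j≡n-2 (quotient-bound n₂ q r' k k≤ k≡) (ℕ.≤-pred r≤n-1)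
    Sₖ≐S₀ : Sₖ t ≐ S₀ t
    Sₖ≐S₀ = agree t (subst (t ≤_) k≡ t≤k)
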